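{- Let $\mathcal T$ be a tangle of order $k$ in a connectivity system $(E,\lambda)$. Let $X$ be a $\mathcal T$-strong $k$-separating set, and let $(X_i)_{i=1}^m$ be a partial $k$-sequence for $X$. Then $\mathrm{fcl}_{\mathcal T}(X)=X\cup\bigcup_{i=1}^m X_i$ if and only if $(X_i)_{i=1}^m$ is maximal.
   Context: A connectivity system is a pair $(E,\lambda)$ with $E$ finite and $\lambda$ an integer-valued symmetric ($\lambda(X)=\lambda(E-X)$) submodular function on subsets of $E$. $X$ is $k$-separating if $\lambda(X)\le k$. A tangle of order $k$ is a collection $\mathcal T$ of subsets of $E$ with (T1) $\lambda(A)<k$ for $A\in\mathcal T$; (T2) if $\lambda(A)\le k-1$ then $A\in\mathcal T$ or $E-A\in\mathcal T$; (T3) no three members have union $E$; (T4) $E-\{e\}\notin\mathcal T$. $X$ is $\mathcal T$-weak if contained in a member of $\mathcal T$, else $\mathcal T$-strong. A $\mathcal T$-strong $k$-separating set $X$ is fully closed if there is no non-empty $\mathcal T$-weak $Y\subseteq E-X$ with $X\cup Y$ $k$-separating; $\mathrm{fcl}_{\mathcal T}(X)$ is the intersection of all fully closed $k$-separating sets containing $X$. A partial $k$-sequence for $X$ is a sequence $(X_i)_{i=1}^m$ of pairwise disjoint non-empty $\mathcal T$-weak subsets of $E-X$ such that $X\cup\bigcup_{i=1}^j X_i$ is $k$-separating for every $j\in\{1,\dots,m\}$. It is maximal if the set $X\cup\bigcup_{i=1}^m X_i$ is maximal under inclusion among all sets of the form $X\cup\bigcup_i Y_i$ with $(Y_i)$ a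 partial $k$-sequence for $X$. -}

module Defs where

open import Data.Nat using (ℕ; _<?_) renaming (_≤_ to _≤ℕ_)
open import Data.Fin using (Fin; toℕ)
open import Data.Fin.Subset using (Subset; _∪_; _∩_; ∁; _⊆_; _∈_; ⊤; ⁅_⁆; ⋃; Nonempty; Empty)
open import Data.Integer using (ℤ; _+_; _-_; _≤_; _<_; 1ℤ)
open import Data.List using (List; map; filter; allFin)
open import Data.Product using (Σ; _×_; ∃)
open import Data.Sum using (_⊎_)
open import Relation.Nullary using (¬_)
open import Relation.Binary.PropositionalEquality using (_≡_; _≢_)

record ConnectivitySystem (n : ℕ) : Set where
  field
    λc          : Subset n → ℤ
    symmetric   : ∀ X → λc X ≡ λc (∁ X)
    submodular  : ∀ X Y → λc (X ∪ Y) + λc (X ∩ Y) ≤ λc X + λc Y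

module _ {n : ℕ} (C : ConnectivitySystem n) where
  open ConnectivitySystem C

  Separating : ℤ → Subset n → Set
  Separating k X = λc X ≤ k

  record IsTangle (k : ℤ) (𝒯 : Subset n → Set) : Set where
    field
      T1 : ∀ A → 𝒯 A → λc A < k
      T2 : ∀ A → λc A ≤ k - 1ℤ → 𝒯 A ⊎ 𝒯 (∁ A)
      T3 : ∀ A B C → 𝒯 A → 𝒯 B → 𝒯 C → (A ∪ B) ∪ C ≢ ⊤
      T4 : ∀ e → ¬ 𝒯 (∁ ⁅ e ⁆)

  module _ (k : ℤ) (𝒯 : Subset n → Set) where

    Weak : Subset n → Set
    Weak X = ∃ λ A → 𝒯 A × X ⊆ A

    Strong : Subset n → Set
    Strong X = ¬ Weak X

    FullyClosed : Subset n → Set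
    FullyClosed X =
      Strong X × Separating k X ×
      (¬ (∃ λ Y → Nonempty Y × Weak Y × Y ⊆ ∁ X × Separating k (X ∪ Y)))

    InFcl : Subset n → Fin n → Set
    InFcl X e = ∀ F → FullyClosed F → Separating k F → X ⊆ F → e ∈ F

    prefixUnion : {m : ℕ} → (Fin m → Subset n) → ℕ → Subset n
    prefixUnion {m} Xs j = ⋃ (map Xs (filter (λ i → toℕ i <? j) (allFin m)))

    -- partial k-sequence for X (indices 1..m are represented by Fin m)
    record PartialSeq (X : Subset n) (m : ℕ) (Xs : Fin m → Subset n) : Set where
      field
        disjoint  : ∀ i j → i ≢ j → Empty (Xs i ∩ Xs j)
        nonempty  : ∀ i → Nonempty (Xs i)
        weak      : ∀ i → Weak (Xs i)
        outside   : ∀ i → Xs i ⊆ ∁ X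
        separates : ∀ j → 1 ≤ℕ j → j ≤ℕ m → Separating k (X ∪ prefixUnion Xs j)

    seqSet : Subset n → {m : ℕ} → (Fin m → Subset n) → Subset n
    seqSet X {m} Xs = X ∪ prefixUnion Xs m

    Maximal : (X : Subset n) (m : ℕ) (Xs : Fin m → Subset n) → Set
    Maximal X m Xs = ∀ m' (Ys : Fin m' → Subset n) → PartialSeq X m' Ys →
      seqSet X Xs ⊆ seqSet X Ys → seqSet X Ys ⊆ seqSet X Xs

module Submission where

-- The proof rests on one absorption property of fully closed sets Z: if V is
-- k-separating, Z ∩ V is 𝒯-strong and V ⊆ Z ∪ Y with Y 𝒯-weak, then V ⊆ Z.
-- (Otherwise λ(Z ∩ V) ≥ k, because a smaller strong set would put ∁Z in 𝒯;
-- submodularity then makes Z ∪ (V ∖ Z) k-separating, a forbidden weak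
-- extension of Z.)  Applying it along the prefixes of a partial sequence shows
-- that the set of EVERY partial k-sequence lies in every fully closed set
-- containing X, hence in fcl(X).  Conversely, if (X_i) is maximal its set S
-- is fully closed: a weak extension Y of S could be appended to the sequence,
-- giving a partial sequence with the strictly larger set S ∪ Y.

open import Defs
open import Data.Nat using (ℕ)
open import Data.Integer using (ℤ)
open import Data.Fin using (Fin)
open import Data.Fin.Subset using (Subset; _∈_)
open import Data.Product using (_×_)
open import Function.Bundles using (_⇔_)

open import Data.Nat as ℕ using (zero; suc; s≤s; z≤n) renaming (_≤_ to _≤ℕ_; _<_ to _<ℕ_)
import Data.Nat.Properties as ℕP
open import Data.Integer as ℤ using (_+_; _-_; 1ℤ; _≤_; _<_)
import Data.Integer.Properties as ℤP
open import Data.Fin using (toℕ; fromℕ<; fromℕ; inject₁)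
import Data.Fin.Properties as FP
open import Data.Fin.Subset using (_∪_; _∩_; ∁; _⊆_; ⊤; ⊥; ⋃; Nonempty; Empty)
open import Data.Fin.Subset.Properties
open import Data.List using (List; []; _∷_; map; filter; allFin)
open import Data.List.Membership.Propositional using () renaming (_∈_ to _∈ₗ_)
open import Data.List.Membership.Propositional.Properties using (∈-map∘filter⁻; ∈-map∘filter⁺; ∈-allFin)
open import Data.List.Relation.Unary.Any using (here; there)
open import Data.Product using (∃; _,_; proj₁; proj₂)
open import Data.Sum using (_⊎_; inj₁; inj₂; [_,_]′)
open import Data.Empty using (⊥-elim) renaming (⊥ to False)
open import Relation.Nullary using (¬_; yes; no)
open import Relation.Binary.PropositionalEquality
open import Function using (_∘_; id)
open import Function.Bundles using (mk⇔; Equivalence)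

module _ {n : ℕ} where

  ⋃⁻ : ∀ {x : Fin n} (L : List (Subset n)) → x ∈ ⋃ L → ∃ λ S → S ∈ₗ L × x ∈ S
  ⋃⁻ []      x∈ = ⊥-elim (∉⊥ x∈)
  ⋃⁻ (S ∷ L) x∈ with x∈p∪q⁻ S (⋃ L) x∈
  ... | inj₁ x∈S = S , here refl , x∈S
  ... | inj₂ x∈⋃L with ⋃⁻ L x∈⋃L
  ...   | T , T∈L , x∈T = T , there T∈L , x∈T

  ⋃⁺ : ∀ {x : Fin n} {S} (L : List (Subset n)) → S ∈ₗ L → x ∈ S → x ∈ ⋃ L
  ⋃⁺ (S ∷ L) (here refl) x∈S = x∈p∪q⁺ (inj₁ x∈S)
  ⋃⁺ (T ∷ L) (there S∈L) x∈S = x∈p∪q⁺ (inj₂ (⋃⁺ L S∈L x∈S))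

  ∁⊤≡⊥ : ∁ (⊤ {n}) ≡ ⊥
  ∁⊤≡⊥ = trans (sym (∩-identityˡ (∁ ⊤))) (∩-inverseʳ ⊤)

  ∪-mono-⊆ : ∀ {A A′ B B′ : Subset n} → A ⊆ A′ → B ⊆ B′ → A ∪ B ⊆ A′ ∪ B′
  ∪-mono-⊆ {A} {B = B} A⊆ B⊆ x∈ = [ x∈p∪q⁺ ∘ inj₁ ∘ A⊆ , x∈p∪q⁺ ∘ inj₂ ∘ B⊆ ]′ (x∈p∪q⁻ A B x∈)

  ∪-∩∁ : ∀ (Z V : Subset n) → Z ∪ (V ∩ ∁ Z) ≡ Z ∪ V
  ∪-∩∁ Z V = begin
    Z ∪ (V ∩ ∁ Z)           ≡⟨ ∪-distribˡ-∩ Z V (∁ Z) ⟩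
    (Z ∪ V) ∩ (Z ∪ ∁ Z)     ≡⟨ cong ((Z ∪ V) ∩_) (p∪∁p≡⊤ Z) ⟩
    (Z ∪ V) ∩ ⊤             ≡⟨ ∩-identityʳ (Z ∪ V) ⟩
    Z ∪ V                   ∎
    where open ≡-Reasoning

+-cancelʳ-≤ : ∀ {a b c : ℤ} → a + c ≤ b + c → a ≤ b
+-cancelʳ-≤ {c = c} a+c≤b+c = ℤP.≮⇒≥ (λ b<a → ℤP.<⇒≱ (ℤP.+-monoˡ-< c b<a) a+c≤b+c)

half-≤ : ∀ {a b : ℤ} → a + a ≤ b + b → a ≤ b
half-≤ a+a≤b+b = ℤP.≮⇒≥ (λ b<a → ℤP.<⇒≱ (ℤP.+-mono-< b<a b<a) a+a≤b+b)

<⇒≤-1 : ∀ {a b : ℤ} → a < b → a ≤ b - 1ℤ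
<⇒≤-1 {a} {b} a<b = subst (a ≤_) (ℤP.+-comm ℤ.-1ℤ b) (ℤP.i<j⇒i≤pred[j] a<b)

module Connectivity {n : ℕ} (C : ConnectivitySystem n) where
  open ConnectivitySystem C

  -- The whole ground set has the least connectivity:
  -- 2λ(E) = λ(W ∪ ∁W) + λ(W ∩ ∁W) ≤ λ(W) + λ(∁W) = 2λ(W).
  λ⊤-minimal : ∀ W → λc ⊤ ≤ λc W
  λ⊤-minimal W = half-≤ (subst₂ _≤_ lhs rhs (submodular W (∁ W)))
    where
      lhs : λc (W ∪ ∁ W) + λc (W ∩ ∁ W) ≡ λc ⊤ + λc ⊤
      lhs rewrite p∪∁p≡⊤ W | ∩-inverseʳ W | symmetric (⊤ {n}) | ∁⊤≡⊥ {n} = refl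
      rhs : λc W + λc (∁ W) ≡ λc W + λc W
      rhs = cong (λc W +_) (sym (symmetric W))

  union-separating : ∀ k Z V → λc Z ≤ k → λc V ≤ k → k ≤ λc (Z ∩ V) → λc (Z ∪ V) ≤ k
  union-separating k Z V λZ≤k λV≤k k≤λZ∩V = +-cancelʳ-≤ (begin
    λc (Z ∪ V) + k              ≤⟨ ℤP.+-monoʳ-≤ (λc (Z ∪ V)) k≤λZ∩V ⟩
    λc (Z ∪ V) + λc (Z ∩ V)     ≤⟨ submodular Z V ⟩
    λc Z + λc V                 ≤⟨ ℤP.+-mono-≤ λZ≤k λV≤k ⟩
    k + k                       ∎)
    where open ℤP.≤-Reasoning

module Sequences {n : ℕ} (C : ConnectivitySystem n) (k : ℤ) (𝒯 : Subset n → Set) where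
  open ConnectivitySystem C

  -- Abbreviation for X₀ ∪ … ∪ X_{j-1} (terms indexed from 0).
  pU : {m : ℕ} → (Fin m → Subset n) → ℕ → Subset n
  pU = prefixUnion C k 𝒯

  weak-⊆ : ∀ {A B} → A ⊆ B → Weak C k 𝒯 B → Weak C k 𝒯 A
  weak-⊆ A⊆B (T , T∈𝒯 , B⊆T) = T , T∈𝒯 , B⊆T ∘ A⊆B

  strong-⊇ : ∀ {A B} → A ⊆ B → Strong C k 𝒯 A → Strong C k 𝒯 B
  strong-⊇ A⊆B strA = strA ∘ weak-⊆ A⊆B

  ∈pU⁻ : ∀ {m} {Xs : Fin m → Subset n} {j x} → x ∈ pU Xs j → ∃ λ i → toℕ i <ℕ j × x ∈ Xs i
  ∈pU⁻ {m} {Xs} {j} x∈ with ⋃⁻ (map Xs (filter (λ i → toℕ i ℕ.<? j) (allFin m))) x∈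
  ... | S , S∈ , x∈S with ∈-map∘filter⁻ Xs (λ i → toℕ i ℕ.<? j) {xs = allFin m} S∈
  ...   | i , _ , refl , i<j = i , i<j , x∈S

  ∈pU⁺ : ∀ {m} {Xs : Fin m → Subset n} {j x} (i : Fin m) → toℕ i <ℕ j → x ∈ Xs i → x ∈ pU Xs j
  ∈pU⁺ {m} {Xs} {j} i i<j x∈ = ⋃⁺ (map Xs (filter (λ i → toℕ i ℕ.<? j) (allFin m)))
    (∈-map∘filter⁺ Xs (λ i → toℕ i ℕ.<? j) {xs = allFin m} (i , ∈-allFin i , refl , i<j)) x∈

  pU-zero : ∀ {m} (Xs : Fin m → Subset n) → pU Xs 0 ≡ ⊥
  pU-zero Xs = Empty-unique empty
    where
      empty : Empty (pU Xs 0)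
      empty (x , x∈) with ∈pU⁻ {Xs = Xs} x∈
      ... | _ , () , _

  pU⊆full : ∀ {m} (Xs : Fin m → Subset n) j → pU Xs j ⊆ pU Xs m
  pU⊆full Xs j x∈ with ∈pU⁻ {Xs = Xs} x∈
  ... | i , _ , x∈Xi = ∈pU⁺ i (FP.toℕ<n i) x∈Xi

  pU-mono : ∀ {m} (Xs : Fin m → Subset n) {j j′} → j ≤ℕ j′ → pU Xs j ⊆ pU Xs j′
  pU-mono Xs j≤j′ x∈ with ∈pU⁻ {Xs = Xs} x∈
  ... | i , i<j , x∈Xi = ∈pU⁺ i (ℕP.<-≤-trans i<j j≤j′) x∈Xi

  pU-suc : ∀ {m} (Xs : Fin m → Subset n) {j} (j<m : j <ℕ m) →
           pU Xs (suc j) ⊆ pU Xs j ∪ Xs (fromℕ< j<m)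
  pU-suc Xs {j} j<m {x} x∈ with ∈pU⁻ {Xs = Xs} x∈
  ... | i , i<1+j , x∈Xi with ℕP.m<1+n⇒m<n∨m≡n i<1+j
  ...   | inj₁ i<j = x∈p∪q⁺ (inj₁ (∈pU⁺ i i<j x∈Xi))
  ...   | inj₂ i≡j = x∈p∪q⁺ (inj₂ (subst (λ t → x ∈ Xs t) i≡last x∈Xi))
    where
      i≡last : i ≡ fromℕ< j<m
      i≡last = FP.toℕ-injective (trans i≡j (sym (FP.toℕ-fromℕ< j<m)))

  X∪pU0 : ∀ {m} X (Xs : Fin m → Subset n) → X ∪ pU Xs 0 ≡ X
  X∪pU0 X Xs = trans (cong (X ∪_) (pU-zero Xs)) (∪-identityʳ X)

  term⊆seqSet : ∀ {m} X (Xs : Fin m → Subset n) i → Xs i ⊆ seqSet C k 𝒯 X Xs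
  term⊆seqSet X Xs i = q⊆p∪q X (pU Xs _) ∘ ∈pU⁺ i (FP.toℕ<n i)

  seqSet-separating : ∀ {X m Xs} → PartialSeq C k 𝒯 X m Xs → Separating C k X →
                      Separating C k (seqSet C k 𝒯 X Xs)
  seqSet-separating {X} {zero} {Xs} _ sepX = subst (λ S → λc S ≤ k) (sym (X∪pU0 X Xs)) sepX
  seqSet-separating {m = suc m} ps _ = PartialSeq.separates ps (suc m) (s≤s z≤n) ℕP.≤-refl

  snoc : ∀ {m} → (Fin m → Subset n) → Subset n → Fin (suc m) → Subset n
  snoc {m} Xs Y i with toℕ i ℕ.<? m
  ... | yes i<m = Xs (fromℕ< i<m)
  ... | no _    = Y

  snoc-view : ∀ {m} (Xs : Fin m → Subset n) Y (i : Fin (suc m)) →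
    (∃ λ (i<m : toℕ i <ℕ m) → snoc Xs Y i ≡ Xs (fromℕ< i<m)) ⊎ (toℕ i ≡ m × snoc Xs Y i ≡ Y)
  snoc-view {m} Xs Y i with toℕ i ℕ.<? m
  ... | yes i<m = inj₁ (i<m , refl)
  ... | no i≮m  = inj₂ (ℕP.≤-antisym (ℕ.s≤s⁻¹ (FP.toℕ<n i)) (ℕP.≮⇒≥ i≮m) , refl)

  snoc-inject₁ : ∀ {m} (Xs : Fin m → Subset n) Y a → snoc Xs Y (inject₁ a) ≡ Xs a
  snoc-inject₁ Xs Y a with snoc-view Xs Y (inject₁ a)
  ... | inj₁ (i<m , e) =
    trans e (cong Xs (FP.toℕ-injective (trans (FP.toℕ-fromℕ< i<m) (FP.toℕ-inject₁ a))))
  ... | inj₂ (i≡m , _) = ⊥-elim (ℕP.<-irrefl (trans (sym (FP.toℕ-inject₁ a)) i≡m) (FP.toℕ<n a))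

  snoc-last : ∀ {m} (Xs : Fin m → Subset n) Y → snoc Xs Y (fromℕ m) ≡ Y
  snoc-last {m} Xs Y with snoc-view Xs Y (fromℕ m)
  ... | inj₁ (m<m , _) = ⊥-elim (ℕP.<-irrefl (FP.toℕ-fromℕ m) m<m)
  ... | inj₂ (_ , e)   = e

  ∈pU-snoc⁻ : ∀ {m} (Xs : Fin m → Subset n) Y {j x} →
              x ∈ pU (snoc Xs Y) j → x ∈ pU Xs j ⊎ (m <ℕ j × x ∈ Y)
  ∈pU-snoc⁻ Xs Y {j} {x} x∈ with ∈pU⁻ {Xs = snoc Xs Y} x∈
  ... | i , i<j , x∈Yi with snoc-view Xs Y i
  ...   | inj₁ (i<m , e) = inj₁ (∈pU⁺ (fromℕ< i<m) (subst (_<ℕ j) (sym (FP.toℕ-fromℕ< i<m)) i<j)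
                                     (subst (x ∈_) e x∈Yi))
  ...   | inj₂ (i≡m , e) = inj₂ (subst (_<ℕ j) i≡m i<j , subst (x ∈_) e x∈Yi)

  ∈pU-snoc⁺ : ∀ {m} (Xs : Fin m → Subset n) Y {j} → pU Xs j ⊆ pU (snoc Xs Y) j
  ∈pU-snoc⁺ Xs Y {j} {x} x∈ with ∈pU⁻ {Xs = Xs} x∈
  ... | a , a<j , x∈Xa = ∈pU⁺ (inject₁ a) (subst (_<ℕ j) (sym (FP.toℕ-inject₁ a)) a<j)
                               (subst (x ∈_) (sym (snoc-inject₁ Xs Y a)) x∈Xa)

  pU-snoc-≤ : ∀ {m} (Xs : Fin m → Subset n) Y {j} → j ≤ℕ m → pU (snoc Xs Y) j ≡ pU Xs j
  pU-snoc-≤ Xs Y {j} j≤m = ⊆-antisym old (∈pU-snoc⁺ Xs Y)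
    where
      old : pU (snoc Xs Y) j ⊆ pU Xs j
      old x∈ = [ id , (λ (m<j , _) → ⊥-elim (ℕP.<⇒≱ m<j j≤m)) ]′ (∈pU-snoc⁻ Xs Y x∈)

  pU-snoc-all : ∀ {m} (Xs : Fin m → Subset n) Y → pU (snoc Xs Y) (suc m) ≡ pU Xs m ∪ Y
  pU-snoc-all {m} Xs Y = ⊆-antisym split join
    where
      split : pU (snoc Xs Y) (suc m) ⊆ pU Xs m ∪ Y
      split x∈ = x∈p∪q⁺ (Data.Sum.map (pU⊆full Xs (suc m)) proj₂ (∈pU-snoc⁻ Xs Y x∈))
      last : Y ⊆ pU (snoc Xs Y) (suc m)
      last {x} x∈Y = ∈pU⁺ (fromℕ m) (subst (_<ℕ suc m) (sym (FP.toℕ-fromℕ m)) (ℕP.n<1+n m))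
                          (subst (x ∈_) (sym (snoc-last Xs Y)) x∈Y)
      join : pU Xs m ∪ Y ⊆ pU (snoc Xs Y) (suc m)
      join {x} x∈ = [ pU-mono (snoc Xs Y) (ℕP.n≤1+n m) ∘ ∈pU-snoc⁺ Xs Y , last ]′ (x∈p∪q⁻ (pU Xs m) Y x∈)

  seqSet-snoc : ∀ {m} X (Xs : Fin m → Subset n) Y →
                seqSet C k 𝒯 X (snoc Xs Y) ≡ seqSet C k 𝒯 X Xs ∪ Y
  seqSet-snoc {m} X Xs Y = begin
    X ∪ pU (snoc Xs Y) (suc m)    ≡⟨ cong (X ∪_) (pU-snoc-all Xs Y) ⟩
    X ∪ (pU Xs m ∪ Y)             ≡⟨ sym (∪-assoc X (pU Xs m) Y) ⟩
    (X ∪ pU Xs m) ∪ Y             ∎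
    where open ≡-Reasoning

  snoc-disjoint : ∀ {X m Xs Y} → PartialSeq C k 𝒯 X m Xs → Y ⊆ ∁ (seqSet C k 𝒯 X Xs) →
                  ∀ i j → i ≢ j → Empty (snoc Xs Y i ∩ snoc Xs Y j)
  snoc-disjoint {X} {m} {Xs} {Y} ps Y⊆∁S = disjoint
    where
      avoid : ∀ {x a} → x ∈ Xs a → x ∈ Y → False
      avoid {a = a} x∈Xa x∈Y = x∈∁p⇒x∉p (Y⊆∁S x∈Y) (term⊆seqSet X Xs a x∈Xa)

      same-index : ∀ {i j} (i<m : toℕ i <ℕ m) (j<m : toℕ j <ℕ m) → fromℕ< i<m ≡ fromℕ< j<m → i ≡ j
      same-index {i} {j} i<m j<m eq = FP.toℕ-injective (begin
        toℕ i              ≡⟨ sym (FP.toℕ-fromℕ< i<m) ⟩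
        toℕ (fromℕ< i<m)   ≡⟨ cong toℕ eq ⟩
        toℕ (fromℕ< j<m)   ≡⟨ FP.toℕ-fromℕ< j<m ⟩
        toℕ j              ∎)
        where open ≡-Reasoning

      disjoint : ∀ i j → i ≢ j → Empty (snoc Xs Y i ∩ snoc Xs Y j)
      disjoint i j i≢j (x , x∈)
        with x∈p∩q⁻ (snoc Xs Y i) (snoc Xs Y j) x∈ | snoc-view Xs Y i | snoc-view Xs Y j
      ... | x∈i , x∈j | inj₁ (i<m , e) | inj₁ (j<m , e′) =
        PartialSeq.disjoint ps (fromℕ< i<m) (fromℕ< j<m) (i≢j ∘ same-index i<m j<m)
          (x , x∈p∩q⁺ (subst (x ∈_) e x∈i , subst (x ∈_) e′ x∈j))
      ... | x∈i , x∈j | inj₁ (_ , e) | inj₂ (_ , e′) = avoid (subst (x ∈_) e x∈i) (subst (x ∈_) e′ x∈j)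
      ... | x∈i , x∈j | inj₂ (_ , e) | inj₁ (_ , e′) = avoid (subst (x ∈_) e′ x∈j) (subst (x ∈_) e x∈i)
      ... | _ | inj₂ (i≡m , _) | inj₂ (j≡m , _) = i≢j (FP.toℕ-injective (trans i≡m (sym j≡m)))

  snoc-partialSeq : ∀ {X m Xs Y} → PartialSeq C k 𝒯 X m Xs →
                    Nonempty Y → Weak C k 𝒯 Y → Y ⊆ ∁ (seqSet C k 𝒯 X Xs) →
                    Separating C k (seqSet C k 𝒯 X Xs ∪ Y) →
                    PartialSeq C k 𝒯 X (suc m) (snoc Xs Y)
  snoc-partialSeq {X} {m} {Xs} {Y} ps neY wY Y⊆∁S sepS∪Y = record
    { disjoint  = snoc-disjoint ps Y⊆∁S
    ; nonempty  = λ i → by-cases i (PartialSeq.nonempty ps) neY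
    ; weak      = λ i → by-cases i (PartialSeq.weak ps) wY
    ; outside   = λ i → by-cases {P = _⊆ ∁ X} i (PartialSeq.outside ps)
                                                 (p⊆q⇒∁p⊇∁q (p⊆p∪q (pU Xs m)) ∘ Y⊆∁S)
    ; separates = separates
    }
    where
      by-cases : ∀ {P : Subset n → Set} i → (∀ a → P (Xs a)) → P Y → P (snoc Xs Y i)
      by-cases {P} i old new with snoc-view Xs Y i
      ... | inj₁ (i<m , e) = subst P (sym e) (old (fromℕ< i<m))
      ... | inj₂ (_ , e)   = subst P (sym e) new
      separates : ∀ j → 1 ≤ℕ j → j ≤ℕ suc m → Separating C k (X ∪ pU (snoc Xs Y) j)
      separates j 1≤j j≤1+m with j ℕ.≤? m
      ... | yes j≤m = subst (λ S → λc S ≤ k) (cong (X ∪_) (sym (pU-snoc-≤ Xs Y j≤m)))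
                            (PartialSeq.separates ps j 1≤j j≤m)
      ... | no j≰m rewrite ℕP.≤-antisym j≤1+m (ℕP.≰⇒> j≰m) =
        subst (λ S → λc S ≤ k) (sym (seqSet-snoc X Xs Y)) sepS∪Y

module Closure {n : ℕ} (C : ConnectivitySystem n) (k : ℤ) (𝒯 : Subset n → Set)
               (tangle : IsTangle C k 𝒯) where
  open ConnectivitySystem C
  open IsTangle tangle
  open Connectivity C
  open Sequences C k 𝒯

  complement-in-tangle : ∀ W → Strong C k 𝒯 W → λc W < k → 𝒯 (∁ W)
  complement-in-tangle W strW λW<k with T2 W (<⇒≤-1 λW<k)
  ... | inj₁ W∈𝒯  = ⊥-elim (strW (W , W∈𝒯 , id))
  ... | inj₂ ∁W∈𝒯 = ∁W∈𝒯

  -- Inside a fully closed set Z ≠ E every 𝒯-strong set has order at least k: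
  -- otherwise the weak set ∁Z would extend Z to the k-separating set E.
  strong-⊆-fullyClosed : ∀ {Z W} → FullyClosed C k 𝒯 Z → Nonempty (∁ Z) →
                         Strong C k 𝒯 W → W ⊆ Z → k ≤ λc W
  strong-⊆-fullyClosed {Z} {W} (_ , _ , closed) ne∁Z strW W⊆Z = ℤP.≮⇒≥ λ λW<k →
    closed (∁ Z , ne∁Z , (∁ W , complement-in-tangle W strW λW<k , p⊆q⇒∁p⊇∁q W⊆Z) , id ,
            subst (λ S → λc S ≤ k) (sym (p∪∁p≡⊤ Z)) (ℤP.≤-trans (λ⊤-minimal W) (ℤP.<⇒≤ λW<k)))

  -- Absorption: a k-separating V meeting the fully closed Z in a strong set,
  -- and covered by Z together with a weak set, lies inside Z; otherwise
  -- V ∖ Z would be a weak extension of Z.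
  absorb : ∀ {Z V Y} → FullyClosed C k 𝒯 Z → Separating C k V → Strong C k 𝒯 (Z ∩ V) →
           Weak C k 𝒯 Y → V ⊆ Z ∪ Y → V ⊆ Z
  absorb {Z} {V} {Y} fcZ@(_ , sepZ , closed) sepV strZ∩V wY V⊆Z∪Y {x} x∈V with x ∈? Z
  ... | yes x∈Z = x∈Z
  ... | no x∉Z  = ⊥-elim (closed (V ∩ ∁ Z , (x , x∈p∩q⁺ (x∈V , x∉p⇒x∈∁p x∉Z)) ,
                                  weak-⊆ V∖Z⊆Y wY , p∩q⊆q V (∁ Z) , separating))
    where
      k≤λZ∩V : k ≤ λc (Z ∩ V)
      k≤λZ∩V = strong-⊆-fullyClosed fcZ (x , x∉p⇒x∈∁p x∉Z) strZ∩V (p∩q⊆p Z V)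
      separating : Separating C k (Z ∪ (V ∩ ∁ Z))
      separating = subst (λ S → λc S ≤ k) (sym (∪-∩∁ Z V)) (union-separating k Z V sepZ sepV k≤λZ∩V)
      V∖Z⊆Y : V ∩ ∁ Z ⊆ Y
      V∖Z⊆Y y∈ with x∈p∩q⁻ V (∁ Z) y∈
      ... | y∈V , y∈∁Z = [ ⊥-elim ∘ x∈∁p⇒x∉p y∈∁Z , id ]′ (x∈p∪q⁻ Z Y (V⊆Z∪Y y∈V))

  -- The set of every partial k-sequence for a strong X lies in every fully
  -- closed set containing X: absorb the prefixes one term at a time.
  seqSet⊆fullyClosed : ∀ {X m Xs Z} → PartialSeq C k 𝒯 X m Xs → Strong C k 𝒯 X →
                       FullyClosed C k 𝒯 Z → X ⊆ Z → seqSet C k 𝒯 X Xs ⊆ Z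
  seqSet⊆fullyClosed {X} {m} {Xs} {Z} ps strX fcZ X⊆Z = prefix⊆ m ℕP.≤-refl
    where
      prefix⊆ : ∀ j → j ≤ℕ m → X ∪ pU Xs j ⊆ Z
      prefix⊆ zero _ = subst (_⊆ Z) (sym (X∪pU0 X Xs)) X⊆Z
      prefix⊆ (suc j) 1+j≤m =
        absorb fcZ (PartialSeq.separates ps (suc j) (s≤s z≤n) 1+j≤m)
               (strong-⊇ (λ x∈X → x∈p∩q⁺ (X⊆Z x∈X , p⊆p∪q (pU Xs (suc j)) x∈X)) strX)
               (PartialSeq.weak ps (fromℕ< 1+j≤m)) covered
        where
          covered : X ∪ pU Xs (suc j) ⊆ Z ∪ Xs (fromℕ< 1+j≤m)
          -- X ∪ P_{j+1} ⊆ X ∪ (P_j ∪ X_j) = (X ∪ P_j) ∪ X_j ⊆ Z ∪ X_j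
          covered {x} x∈ = ∪-mono-⊆ (prefix⊆ j (ℕP.<⇒≤ 1+j≤m)) id
            (subst (x ∈_) (sym (∪-assoc X (pU Xs j) _)) (∪-mono-⊆ id (pU-suc Xs 1+j≤m) x∈))

  seqSet⊆fcl : ∀ {X m Xs} → PartialSeq C k 𝒯 X m Xs → Strong C k 𝒯 X →
               ∀ {e} → e ∈ seqSet C k 𝒯 X Xs → InFcl C k 𝒯 X e
  seqSet⊆fcl ps strX e∈ F fcF _ X⊆F = seqSet⊆fullyClosed ps strX fcF X⊆F e∈

  -- The set of a maximal partial sequence is fully closed: a weak extension
  -- Y could be appended, giving a partial sequence with the larger set S ∪ Y.
  maximal⇒fullyClosed : ∀ {X m Xs} → PartialSeq C k 𝒯 X m Xs → Strong C k 𝒯 X →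
                        Separating C k X → Maximal C k 𝒯 X m Xs →
                        FullyClosed C k 𝒯 (seqSet C k 𝒯 X Xs)
  maximal⇒fullyClosed {X} {m} {Xs} ps strX sepX maximal =
    strong-⊇ (p⊆p∪q (pU Xs m)) strX , seqSet-separating ps sepX , closed
    where
      S = seqSet C k 𝒯 X Xs
      closed : ¬ (∃ λ Y → Nonempty Y × Weak C k 𝒯 Y × Y ⊆ ∁ S × Separating C k (S ∪ Y))
      closed (Y , (y , y∈Y) , wY , Y⊆∁S , sepS∪Y) = x∈∁p⇒x∉p (Y⊆∁S y∈Y) (S∪Y⊆S (q⊆p∪q S Y y∈Y))
        where
          S∪Y⊆S : S ∪ Y ⊆ S
          S∪Y⊆S = subst (_⊆ S) (seqSet-snoc X Xs Y)
            (maximal (suc m) (snoc Xs Y) (snoc-partialSeq ps (y , y∈Y) wY Y⊆∁S sepS∪Y)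
                     (subst (S ⊆_) (sym (seqSet-snoc X Xs Y)) (p⊆p∪q Y)))

lemma3p6 : {n : ℕ} (C : ConnectivitySystem n) (k : ℤ) (𝒯 : Subset n → Set) →
    IsTangle C k 𝒯 →
    (X : Subset n) → Strong C k 𝒯 X → Separating C k X →
    (m : ℕ) (Xs : Fin m → Subset n) → PartialSeq C k 𝒯 X m Xs →
    ((∀ e → InFcl C k 𝒯 X e ⇔ e ∈ seqSet C k 𝒯 X Xs) ⇔ Maximal C k 𝒯 X m Xs)
lemma3p6 C k 𝒯 tangle X strX sepX m Xs ps = mk⇔ closure⇒maximal maximal⇒closure
  where
    open Closure C k 𝒯 tangle
    S = seqSet C k 𝒯 X Xs

    -- every partial sequence has its set inside fcl(X) = S
    closure⇒maximal : (∀ e → InFcl C k 𝒯 X e ⇔ e ∈ S) → Maximal C k 𝒯 X m Xs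
    closure⇒maximal fcl≡S _ _ psY _ e∈ = Equivalence.to (fcl≡S _) (seqSet⊆fcl psY strX e∈)

    -- S is fully closed, so fcl(X) ⊆ S; and S ⊆ fcl(X) always
    maximal⇒closure : Maximal C k 𝒯 X m Xs → (∀ e → InFcl C k 𝒯 X e ⇔ e ∈ S)
    maximal⇒closure maximal e = mk⇔ (λ e∈fcl → e∈fcl S S-closed S-separating (p⊆p∪q _))
                                    (seqSet⊆fcl ps strX)
      where
        S-closed : FullyClosed C k 𝒯 S
        S-closed = maximal⇒fullyClosed ps strX sepX maximal
        S-separating : Separating C k S
        S-separating = proj₁ (proj₂ S-closed)
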